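{- Let $M$ be a $0/1$ matrix with rows indexed by a set $\Sigma_P$ and columns indexed by a set $\Sigma_T$. Let $M'$ be obtained from $M$ in two steps: 1. remove duplicate rows and columns, keeping exactly one copy of each distinct row and each distinct column; 2. remove every row and every column consisting only of zeros. If $M$ does not contain the wildcard matrix, then $M'$ is an identity matrix up to a permutation of its rows and columns.
   Context: $M$ contains the wildcard matrix if some $2\times 2$ submatrix of $M$ (choice of two rows and two columns) equals $\begin{pmatrix}1&1\\1&0\end{pmatrix}$ after some permutation of its rows and columns. -}

module Defs where

open import Data.Bool using (Bool; true; false; T; not)
open import Data.Nat using (ℕ)
open import Data.Fin using (Fin; cast)
open import Data.Fin.Properties using () renaming (_≟_ to _≟ᶠ_)
open import Data.Fin.Permutation using (Permutation′; _⟨$⟩ʳ_)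
open import Data.List using (List; length; lookup; filter; deduplicate; allFin)
open import Data.List.Relation.Unary.Any using (any?)
open import Data.Vec using (Vec; tabulate)
open import Data.Vec.Properties using (≡-dec)
open import Data.Bool.Properties using () renaming (_≟_ to _≟ᵇ_)
open import Data.Product using (Σ; ∃; ∃₂; _×_; _,_)
open import Relation.Nullary using (¬_; ¬?)
open import Relation.Nullary.Decidable using (⌊_⌋)
open import Relation.Binary.PropositionalEquality using (_≡_; _≢_)

Matrix : ℕ → ℕ → Set
Matrix p t = Fin p → Fin t → Bool

-- M contains the wildcard matrix: some 2×2 submatrix (two distinct rows,
-- two distinct columns) equals (1 1 / 1 0) after permuting its rows and columns.
-- Quantifying over ordered pairs of rows/columns absorbs the permutations.
ContainsWildcard : ∀ {p t} → Matrix p t → Set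
ContainsWildcard {p} {t} M =
  Σ (Fin p) λ r₁ → Σ (Fin p) λ r₂ → Σ (Fin t) λ c₁ → Σ (Fin t) λ c₂ →
    r₁ ≢ r₂ × c₁ ≢ c₂ ×
    M r₁ c₁ ≡ true × M r₁ c₂ ≡ true × M r₂ c₁ ≡ true × M r₂ c₂ ≡ false

module Reduce {p t : ℕ} (M : Matrix p t) where

  rowVec : Fin p → Vec Bool t
  rowVec i = tabulate (M i)

  colVec : Fin t → Vec Bool p
  colVec j = tabulate (λ i → M i j)

  rows₁ : List (Fin p)
  rows₁ = deduplicate (λ i i′ → ≡-dec _≟ᵇ_ (rowVec i) (rowVec i′)) (allFin p)

  cols₁ : List (Fin t)
  cols₁ = deduplicate (λ j j′ → ≡-dec _≟ᵇ_ (colVec j) (colVec j′)) (allFin t)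

  rows₂ : List (Fin p)
  rows₂ = filter (λ i → any? (λ j → M i j ≟ᵇ true) cols₁) rows₁

  cols₂ : List (Fin t)
  cols₂ = filter (λ j → any? (λ i → M i j ≟ᵇ true) rows₁) cols₁

  M′ : Matrix (length rows₂) (length cols₂)
  M′ a b = M (lookup rows₂ a) (lookup cols₂ b)

IsPermutedIdentity : ∀ {k l} → Matrix k l → Set
IsPermutedIdentity {k} {l} N =
  Σ (k ≡ l) λ eq → ∃₂ λ (π : Permutation′ k) (ρ : Permutation′ k) →
    ∀ i j → N (π ⟨$⟩ʳ i) (cast eq (ρ ⟨$⟩ʳ j)) ≡ ⌊ i ≟ᶠ j ⌋

-- In a wildcard-free matrix two columns having a 1 in a common row are equal:
-- a row where they differ would complete a wildcard.  After deduplication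
-- distinct columns are therefore never 1 in the same row, and symmetrically
-- for rows; after removing zero lines every row and column has a 1.  So the
-- 1-entries of M′ form the graph of a bijection between its rows and columns.
module Submission where

open import Defs

open import Data.Bool using (Bool; true; false)
open import Data.Bool.Properties using () renaming (_≟_ to _≟ᵇ_)
open import Data.Empty using (⊥-elim)
open import Data.Fin using (Fin; zero; suc)
open import Data.Fin.Properties using (cast-involutive) renaming (_≟_ to _≟ᶠ_)
open import Data.Fin.Permutation using (Permutation; permutation; ↔⇒≡; cast-id; _∘ₚ_)
import Data.Fin.Permutation as Permutation
open import Data.List using (lookup; allFin)
open import Data.List.Membership.Propositional using (_∈_; find; lose)
open import Data.List.Membership.Propositional.Properties using (∈-filter⁺; ∈-filter⁻; ∈-lookup)
import Data.List.Relation.Unary.All as All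
open import Data.List.Relation.Unary.AllPairs using (_∷_)
open import Data.List.Relation.Unary.Any using (any?; index)
open import Data.List.Relation.Unary.Any.Properties using (lookup-index)
open import Data.List.Relation.Unary.Unique.Setoid using (Unique)
open import Data.List.Relation.Unary.Unique.Setoid.Properties using (filter⁺)
open import Data.List.Relation.Unary.Unique.DecSetoid.Properties using (deduplicate-!)
open import Data.Product using (∃; _,_; proj₁; proj₂)
open import Data.Vec using (Vec; tabulate)
open import Data.Vec.Properties using (tabulate-cong; ≡-dec)
open import Function using (_∘_)
open import Relation.Binary.Bundles using (Setoid)
import Relation.Binary.Construct.On as On
open import Relation.Binary.PropositionalEquality using (_≡_; _≢_; refl; sym; trans; cong; subst; setoid; decSetoid)
open import Relation.Nullary using (¬_; yes; no)
open import Relation.Nullary.Decidable using (⌊_⌋)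

module _ {a ℓ} (S : Setoid a ℓ) where
  open Setoid S using (_≈_) renaming (sym to ≈-sym)

  Unique-lookup-injective : ∀ {xs} → Unique S xs →
    ∀ i j → lookup xs i ≈ lookup xs j → i ≡ j
  Unique-lookup-injective (_ ∷ _) zero zero _ = refl
  Unique-lookup-injective (x≉ ∷ _) zero (suc j) x≈ = ⊥-elim (All.lookup x≉ (∈-lookup j) x≈)
  Unique-lookup-injective (x≉ ∷ _) (suc i) zero x≈ = ⊥-elim (All.lookup x≉ (∈-lookup i) (≈-sym x≈))
  Unique-lookup-injective (_ ∷ u) (suc i) (suc j) x≈ = cong suc (Unique-lookup-injective u i j x≈)

transpose : ∀ {p t} → Matrix p t → Matrix t p
transpose M j i = M i j

EveryRowHasOne : ∀ {p t} → Matrix p t → Set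
EveryRowHasOne M = ∀ i → ∃ λ j → M i j ≡ true

AtMostOneOnePerRow : ∀ {p t} → Matrix p t → Set
AtMostOneOnePerRow M = ∀ {i j j′} → M i j ≡ true → M i j′ ≡ true → j ≡ j′

module _ {k l} (N : Matrix k l)
         (rowOne : EveryRowHasOne N) (colOne : EveryRowHasOne (transpose N))
         (rowUnique : AtMostOneOnePerRow N) (colUnique : AtMostOneOnePerRow (transpose N))
         where

  private
    columnOf : Fin k → Fin l
    columnOf i = proj₁ (rowOne i)

    rowOf : Fin l → Fin k
    rowOf j = proj₁ (colOne j)

    onesBijection : Permutation k l
    onesBijection = permutation columnOf rowOf
      (λ j → rowUnique (proj₂ (rowOne (rowOf j))) (proj₂ (colOne j)))
      (λ i → colUnique (proj₂ (colOne (columnOf i))) (proj₂ (rowOne i)))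

    entry : ∀ i j → N i (columnOf j) ≡ ⌊ i ≟ᶠ j ⌋
    entry i j with i ≟ᶠ j
    ... | yes refl = proj₂ (rowOne i)
    ... | no i≢j with N i (columnOf j) in eq
    ...   | true  = ⊥-elim (i≢j (colUnique eq (proj₂ (rowOne j))))
    ...   | false = refl

  oneOnePerLine⇒IsPermutedIdentity : IsPermutedIdentity N
  oneOnePerLine⇒IsPermutedIdentity =
    k≡l , Permutation.id , onesBijection ∘ₚ cast-id (sym k≡l) , λ i j →
      trans (cong (N i) (cast-involutive k≡l (sym k≡l) (columnOf j))) (entry i j)
    where k≡l = ↔⇒≡ onesBijection

module _ {p t} (M : Matrix p t) where

  transpose-wildcard : ContainsWildcard (transpose M) → ContainsWildcard M
  transpose-wildcard (j₁ , j₂ , i₁ , i₂ , j₁≢j₂ , i₁≢i₂ , e₁₁ , e₁₂ , e₂₁ , e₂₂) =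
    i₁ , i₂ , j₁ , j₂ , i₁≢i₂ , j₁≢j₂ , e₁₁ , e₂₁ , e₁₂ , e₂₂

  private
    wildcard : ∀ {r i c c′} → M r c ≡ true → M r c′ ≡ true →
      M i c ≡ true → M i c′ ≡ false → ContainsWildcard M
    wildcard {r} {i} {c} {c′} rc rc′ ic ic′ =
      r , i , c , c′ , (λ { refl → true≢false (trans (sym rc′) ic′) })
                     , (λ { refl → true≢false (trans (sym ic) ic′) }) , rc , rc′ , ic , ic′
      where
      true≢false : true ≢ false
      true≢false ()

  noWildcard⇒columnsSharingOneEqual : ¬ ContainsWildcard M →
    ∀ {r c c′} → M r c ≡ true → M r c′ ≡ true → ∀ i → M i c ≡ M i c′
  noWildcard⇒columnsSharingOneEqual nw {c = c} {c′} rc rc′ i with M i c in ic | M i c′ in ic′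
  ... | true  | true  = refl
  ... | false | false = refl
  ... | true  | false = ⊥-elim (nw (wildcard rc rc′ ic ic′))
  ... | false | true  = ⊥-elim (nw (wildcard rc′ rc ic′ ic))

  open Reduce M

  private
    sameColumn : Setoid _ _
    sameColumn = On.setoid (setoid (Vec Bool p)) colVec

  cols₂-unique : Unique sameColumn cols₂
  cols₂-unique = filter⁺ sameColumn _
    (deduplicate-! (On.decSetoid (decSetoid (≡-dec _≟ᵇ_)) colVec) (allFin t))

  M′-everyRowHasOne : EveryRowHasOne M′
  M′-everyRowHasOne a
    with i∈rows₁ , oneInCols₁ ← ∈-filter⁻ (λ i → any? (λ j → M i j ≟ᵇ true) cols₁) (∈-lookup a)
    with j , j∈cols₁ , ij ← find oneInCols₁ =
    index j∈cols₂ , subst (λ j → M (lookup rows₂ a) j ≡ true) (lookup-index j∈cols₂) ij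
    where
    j∈cols₂ : j ∈ cols₂
    j∈cols₂ = ∈-filter⁺ (λ j → any? (λ i → M i j ≟ᵇ true) rows₁) j∈cols₁ (lose i∈rows₁ ij)

  M′-atMostOneOnePerRow : ¬ ContainsWildcard M → AtMostOneOnePerRow M′
  M′-atMostOneOnePerRow nw {j = b} {b′} ab ab′ =
    Unique-lookup-injective sameColumn cols₂-unique b b′
      (tabulate-cong (noWildcard⇒columnsSharingOneEqual nw ab ab′))

-- Reduce (transpose M) reduces to the transpose of Reduce M definitionally,
-- so the column statements are the row statements for transpose M.
mainTheorem4 : ∀ {p t} (M : Matrix p t) → ¬ ContainsWildcard M →
    IsPermutedIdentity (Reduce.M′ M)
mainTheorem4 M nw = oneOnePerLine⇒IsPermutedIdentity (Reduce.M′ M)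
  (M′-everyRowHasOne M) (M′-everyRowHasOne (transpose M))
  (M′-atMostOneOnePerRow M nw) (M′-atMostOneOnePerRow (transpose M) (nw ∘ transpose-wildcard M))
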